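{- Let $\theta_{\mathbf{PL}}:\mathbf{PL}\to\mathbf{NMI}$ be the unique operad morphism sending the generator of $\mathbf{PL}$ (the $2$-indexed tree with root $1$ and one child $2$) to $X_1X_0$. Then for every $n$-indexed rooted tree $T$, $$\theta_{\mathbf{PL}}(T)=X_{f_T(1)}\cdots X_{f_T(n)}.$$
   Context: $\mathbb{K}$ is a field of characteristic $0$. $\mathbf{PL}$ is the operad of (right) pre-Lie algebras, realized as in Chapoton–Livernet: $\mathbf{PL}(n)$ has basis the $n$-indexed rooted trees (rooted trees with vertex set $[n]$), composition being insertion at vertices, and the pre-Lie product $\blacktriangleleft$ corresponds to the tree with root $1$ and one child $2$. For a vertex $i$ of $T$, $f_T(i)$ is its number of children. $\mathbf{NMI}(n)$ is the vector space with basis the words $X_{i_1}\cdots X_{i_n}$ in non-commuting indeterminates $(X_i)_{i\in\mathbb{N}}$; with $D$ the derivation of $\mathbb{K}\langle X_i\rangle_+$ such that $D(X_i)=X_{i+1}$, the operad $\mathbf{NMI}$ has composition $X_{i_1}\cdots X_{i_n}\circ(P_1,\dots,P_n)=D^{i_1}(P_1)\cdots D^{i_n}(P_n)$, unit $X_0$, and right action $(X_{i_1}\cdots X_{i_n})^\sigma=X_{i_{\sigma(1)}}\cdots X_{i_{\sigma(n)}}$. (The morphism $\theta_{\mathbf{PL}}$ exists since $X_1X_0$ satisfies the right pre-Lie relation in $\mathbf{NMI}$.) -}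

module Defs where

open import Level using (Level; _⊔_)
open import Data.Bool.Base using (Bool; true; false; _∧_; if_then_else_; T)
open import Data.Nat.Base as ℕ using (ℕ; zero; suc; _+_)
open import Data.Nat.Properties using (+-comm; _≟_)
open import Data.Fin.Base as Fin using (Fin; zero; suc; _↑ˡ_; _↑ʳ_; punchOut)
import Data.Fin.Properties as FinP
open import Data.Fin.Permutation using (Permutation′; _⟨$⟩ʳ_; _⟨$⟩ˡ_)
open import Data.Maybe.Base as Maybe using (Maybe; just; nothing; is-nothing; _>>=_)
open import Data.Vec.Base as Vec using (Vec; []; _∷_; lookup; tabulate; toList; zipWith; _++_; countᵇ)
import Data.Vec.Properties as VecP
open import Data.List.Base as List using (List; concatMap; [_])
open import Data.Product.Base using (Σ; ∃; _×_; _,_; proj₁; proj₂)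
open import Relation.Nullary using (¬_; does; yes; no)
open import Relation.Nullary.Decidable using (T?)
open import Relation.Binary.PropositionalEquality using (_≡_)
open import Algebra.Bundles using (CommutativeRing)

-- n-indexed rooted trees, encoded by their parent vector:
-- entry i is  just j  if j is the parent of i, and  nothing  if i is the root.

Parents : ℕ → Set
Parents n = Vec (Maybe (Fin n)) n

step : ∀ {n} → Parents n → Maybe (Fin n) → Maybe (Fin n)
step p nothing  = nothing
step p (just j) = lookup p j

iter : ∀ {a} {A : Set a} → ℕ → (A → A) → A → A
iter zero    f x = x
iter (suc k) f x = iter k f (f x)

-- a parent vector is a rooted tree iff there is exactly one root and
-- from every vertex, following parents, one leaves the tree (passes the
-- root) within n steps (i.e. no cycles)
isTree : ∀ {n} → Parents n → Bool
isTree {n} p = (countᵇ is-nothing p ℕ.≡ᵇ 1)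
             ∧ List.foldr (λ j r → is-nothing (iter n (step p) (just j)) ∧ r) true (List.allFin n)

-- basis of PL(n): the n-indexed rooted trees
Tree : ℕ → Set
Tree n = Σ (Parents n) (λ p → T (isTree p))

isChildOf : ∀ {n} → Fin n → Maybe (Fin n) → Bool
isChildOf k nothing  = false
isChildOf k (just q) = does (q FinP.≟ k)

f : ∀ {n} → Tree n → Fin n → ℕ
f T i = countᵇ (isChildOf i) (proj₁ T)

-- the word X_{f_T(1)} ... X_{f_T(n)}  (a word is the vector of indices)
fword : ∀ {n} → Tree n → Vec ℕ n
fword T = tabulate (f T)

-- Partial composition positions: composing at position k of an arity
-- (suc n') object with an arity m object gives arity n' + m; positions
-- before k are kept, the m inserted positions come at k, k+1, ..., and
-- positions after k are shifted by m - 1.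

-- new position of the inserted vertex/letter l
embS : ∀ {n' m} → Fin (suc n') → Fin m → Fin (n' + m)
embS {n'} {m} zero l = Fin.cast (+-comm m n') (l ↑ˡ n')
embS {suc n'} (suc k) l = suc (embS k l)

-- new position of an old vertex/letter, given as punched-out index
embT : ∀ {n' m} → Fin (suc n') → Fin n' → Fin (n' + m)
embT {n'} {m} zero a = Fin.cast (+-comm m n') (m ↑ʳ a)
embT {suc n'} (suc k) zero = zero
embT {suc n'} (suc k) (suc a) = suc (embT k a)

graft : ∀ {A : Set} {n' m} → Fin (suc n') → Vec A (suc n') → Vec A m → Vec A (n' + m)
graft {n' = n'} {m} zero (x ∷ xs) ys = Vec.cast (+-comm m n') (ys ++ xs)
graft {n' = suc n'} (suc k) (x ∷ xs) ys = x ∷ graft k xs ys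

-- Composition in PL (Chapoton–Livernet): T ∘_k S is the sum, over all
-- maps from the children of k in T to the vertices of S, of the tree
-- obtained by replacing k by S, attaching each child of k to its image,
-- and attaching the root of S to the parent of k (if any).

-- all maps from the children of k to Fin m, recorded as a vector that is
-- just b at children of k and nothing elsewhere
assignments : ∀ {N L} (m : ℕ) → Fin N → Vec (Maybe (Fin N)) L → List (Vec (Maybe (Fin m)) L)
assignments m k [] = [ [] ]
assignments m k (x ∷ xs) =
  if isChildOf k x
  then concatMap (λ b → List.map (just b ∷_) (assignments m k xs)) (List.allFin m)
  else List.map (nothing ∷_) (assignments m k xs)

-- new label of a parent of T different from k
mapT : ∀ {n' m} → Fin (suc n') → Fin (suc n') → Maybe (Fin (n' + m))
mapT {m = m} k q with k FinP.≟ q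
... | yes _ = nothing
... | no k≢q = just (embT {m = m} k (punchOut k≢q))

graftTree : ∀ {n' m} → Fin (suc n') → Parents (suc n') → Parents m
          → Vec (Maybe (Fin m)) (suc n') → Parents (n' + m)
graftTree {n'} {m} k pT pS a = graft k newT newS
  where
  newT = zipWith (λ x ax → Maybe.maybe (λ b → just (embS k b)) (x >>= mapT k) ax) pT a
  newS = Vec.map (Maybe.maybe (λ l → just (embS {n'} k l)) (lookup pT k >>= mapT k)) pS

compPL : ∀ {n' m} → Fin (suc n') → Parents (suc n') → Parents m → List (Parents (n' + m))
compPL {m = m} k pT pS = List.map (graftTree k pT pS) (assignments m k pT)

-- right action of the symmetric group on trees: vertex j of T^σ is
-- vertex σ(j) of T  (so that f_{T^σ}(j) = f_T(σ(j)))
actTree : ∀ {n} → Parents n → Permutation′ n → Parents n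
actTree p σ = tabulate (λ j → Maybe.map (σ ⟨$⟩ˡ_) (lookup p (σ ⟨$⟩ʳ j)))

actWord : ∀ {n} → Vec ℕ n → Permutation′ n → Vec ℕ n
actWord w σ = tabulate (λ j → lookup w (σ ⟨$⟩ʳ j))

unitTree : Tree 1
unitTree = (nothing ∷ []) , _

genTree : Tree 2
genTree = (nothing ∷ just zero ∷ []) , _

-- the derivation D on a single word: sum of all single index increments
Dword : ∀ {n} → Vec ℕ n → List (Vec ℕ n)
Dword [] = List.[]
Dword (x ∷ xs) = (suc x ∷ xs) List.∷ List.map (x ∷_) (Dword xs)

module Lin {c ℓ : Level} (K : CommutativeRing c ℓ) where
  open CommutativeRing K renaming (_+_ to _+K_; _*_ to _*K_)

  ofℕ : ℕ → Carrier
  ofℕ zero    = 0#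
  ofℕ (suc n) = 1# +K ofℕ n

  record IsFieldChar0 : Set (c ⊔ ℓ) where
    field
      nontrivial : ¬ (1# ≈ 0#)
      inverse    : ∀ x → ¬ (x ≈ 0#) → ∃ λ y → x *K y ≈ 1#
      char0      : ∀ n → ofℕ n ≈ 0# → n ≡ 0

  -- an element of NMI(n): a formal linear combination of words of length n
  NMI : ℕ → Set c
  NMI n = List (Carrier × Vec ℕ n)

  coeff : ∀ {n} → NMI n → Vec ℕ n → Carrier
  coeff P w = List.foldr (λ cw r → if does (VecP.≡-dec _≟_ (proj₂ cw) w) then proj₁ cw +K r else r) 0# P

  _≈N_ : ∀ {n} → NMI n → NMI n → Set ℓ
  P ≈N Q = ∀ w → coeff P w ≈ coeff Q w

  monomial : ∀ {n} → Vec ℕ n → NMI n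
  monomial w = [ (1# , w) ]

  D : ∀ {n} → NMI n → NMI n
  D = concatMap (λ cw → List.map (proj₁ cw ,_) (Dword (proj₂ cw)))

  -- partial composition in NMI, extended bilinearly:
  -- w ∘_k v = X_{w_1}...X_{w_{k-1}} D^{w_k}(v) X_{w_{k+1}}...
  compWord : ∀ {n' m} → Fin (suc n') → Vec ℕ (suc n') → Vec ℕ m → NMI (n' + m)
  compWord k w v = List.map (λ cv → proj₁ cv , graft k w (proj₂ cv)) (iter (lookup w k) D (monomial v))

  compNMI : ∀ {n' m} → Fin (suc n') → NMI (suc n') → NMI m → NMI (n' + m)
  compNMI k P Q = concatMap (λ cw → concatMap (λ dv →
                    List.map (λ ew → (proj₁ cw *K proj₁ dv) *K proj₁ ew , proj₂ ew)
                             (compWord k (proj₂ cw) (proj₂ dv))) Q) P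

  actNMI : ∀ {n} → NMI n → Permutation′ n → NMI n
  actNMI P σ = List.map (λ cw → proj₁ cw , actWord (proj₂ cw) σ) P

  -- a linear map PL(n) → NMI(n) is given by its values on the basis of trees
  LinMaps : Set c
  LinMaps = ∀ n → Tree n → NMI n

  -- its value on a parent vector (0 if it is not a tree)
  onParents : LinMaps → ∀ {n} → Parents n → NMI n
  onParents θ p with T? (isTree p)
  ... | yes t = θ _ (p , t)
  ... | no _  = List.[]

  onSum : LinMaps → ∀ {n} → List (Parents n) → NMI n
  onSum θ = concatMap (onParents θ)

  record IsOperadMorphism (θ : LinMaps) : Set (c ⊔ ℓ) where
    field
      unit  : θ 1 unitTree ≈N monomial (0 ∷ [])
      comp  : ∀ n' m (k : Fin (suc n')) (T : Tree (suc n')) (S : Tree m)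
              → onSum θ (compPL k (proj₁ T) (proj₁ S)) ≈N compNMI k (θ _ T) (θ _ S)
      equiv : ∀ n (T : Tree n) (σ : Permutation′ n)
              → onParents θ (actTree (proj₁ T) σ) ≈N actNMI (θ n T) σ

-- Induction on the number of vertices and then on the number of leaves. Both θ and T ↦ X_{f_T(1)}⋯X_{f_T(n)}
-- are equivariant, so after relabelling, the last vertex of T is a leaf whose parent is the penultimate vertex k.
-- Removing that leaf gives a tree T′, and T′ ∘ₖ ◁ is the sum, over all ways of sending each child of k either to
-- k or to the new leaf, of the resulting trees: T itself (nothing sent to the leaf) and trees with fewer leaves.
-- On the other side, X_{f_{T′}(1)}⋯X_{f_{T′}(k)} ∘ₖ X₁X₀ puts D^{f_{T′}(k)}(X₁X₀) in position k, and expanding this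
-- derivative by Leibniz's rule gives one word for each of the same assignments, namely the word of the
-- corresponding tree. In θ(T′ ∘ₖ ◁) = θ(T′) ∘ₖ θ(◁) the terms of the trees with fewer leaves then cancel by
-- induction, and what remains is θ(T) = X_{f_T(1)}⋯X_{f_T(n)}.

module Submission where

open import Defs
open import Level using (Level)
open import Function.Base using (_∘_; id)
open import Function.Bundles using (Equivalence; mk⇔)
open import Data.Bool.Base using (Bool; true; false; _∧_; if_then_else_; T)
open import Data.Bool.Properties using (T-irrelevant; T-∧)
open import Data.Nat.Base using (ℕ; zero; suc; _+_; _∸_; _≤_; _<_; z≤n; s≤s; _≡ᵇ_)
import Data.Nat.Properties as ℕP
import Data.Nat.Induction as ℕInd
open import Data.Fin.Base using (Fin; zero; suc; toℕ; fromℕ; punchOut)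
import Data.Fin.Properties as FinP
open import Data.Fin.Permutation using (Permutation′; _⟨$⟩ʳ_; _⟨$⟩ˡ_; inverseˡ; inverseʳ; transpose; flip)
open import Data.Maybe.Base as Maybe using (Maybe; just; nothing; is-nothing; _>>=_)
open import Data.Maybe.Properties using (just-injective)
open import Data.Vec.Base using (Vec; []; _∷_; lookup; countᵇ; tabulate)
import Data.Vec.Properties as VecP
open import Data.List.Base as List using (List; []; _∷_; concatMap; length)
import Data.List.Properties as ListP
open import Data.List.Relation.Unary.All as All using (All; []; _∷_)
import Data.List.Relation.Unary.All.Properties as AllP
open import Data.Product.Base using (∃; ∃₂; _×_; _,_; proj₁; proj₂)
open import Data.Sum.Base using (_⊎_; inj₁; inj₂)
open import Data.Empty using (⊥-elim)
open import Relation.Nullary using (¬_; does; yes; no)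
open import Relation.Nullary.Decidable using (T?; does-⇔)
open import Relation.Binary.PropositionalEquality
  using (_≡_; _≢_; refl; sym; trans; cong; cong₂; subst; subst₂; module ≡-Reasoning)
open import Algebra.Bundles using (CommutativeRing)
import Relation.Binary.Reasoning.Setoid as ≈-Reasoning
open import Algebra.Properties.CommutativeMonoid.Sum ℕP.+-0-commutativeMonoid using (sum; sum-permute; sum-cong-≗)

vec-ext : ∀ {A : Set} {n} {xs ys : Vec A n} → (∀ i → lookup xs i ≡ lookup ys i) → xs ≡ ys
vec-ext {xs = xs} {ys} h = trans (sym (VecP.tabulate∘lookup xs)) (trans (VecP.tabulate-cong h) (VecP.tabulate∘lookup ys))

module _ {A : Set} (P : A → Bool) where

  all-false⇒countᵇ≡0 : ∀ {n} (xs : Vec A n) → (∀ i → P (lookup xs i) ≡ false) → countᵇ P xs ≡ 0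
  all-false⇒countᵇ≡0 [] h = refl
  all-false⇒countᵇ≡0 (x ∷ xs) h with P x | h zero
  ... | false | _ = all-false⇒countᵇ≡0 xs (h ∘ suc)

  countᵇ≡0⇒all-false : ∀ {n} (xs : Vec A n) → countᵇ P xs ≡ 0 → ∀ i → P (lookup xs i) ≡ false
  countᵇ≡0⇒all-false (x ∷ xs) h i with P x in eq
  countᵇ≡0⇒all-false (x ∷ xs) h zero    | false = eq
  countᵇ≡0⇒all-false (x ∷ xs) h (suc i) | false = countᵇ≡0⇒all-false xs h i

  countᵇ≢0⇒∃ : ∀ {n} (xs : Vec A n) → ¬ countᵇ P xs ≡ 0 → ∃ λ i → P (lookup xs i) ≡ true
  countᵇ≢0⇒∃ [] ne = ⊥-elim (ne refl)
  countᵇ≢0⇒∃ (x ∷ xs) ne with P x in eq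
  ... | true  = zero , eq
  ... | false = let i , e = countᵇ≢0⇒∃ xs ne in suc i , e

  countᵇ-≥1 : ∀ {n} (xs : Vec A n) i → P (lookup xs i) ≡ true → 1 ≤ countᵇ P xs
  countᵇ-≥1 (x ∷ xs) zero e rewrite e = s≤s z≤n
  countᵇ-≥1 (x ∷ xs) (suc i) e with P x
  ... | true  = s≤s z≤n
  ... | false = countᵇ-≥1 xs i e

  countᵇ-≥2 : ∀ {n} (xs : Vec A n) i j → i ≢ j → P (lookup xs i) ≡ true → P (lookup xs j) ≡ true
            → 2 ≤ countᵇ P xs
  countᵇ-≥2 (x ∷ xs) zero    zero    i≢j _ _ = ⊥-elim (i≢j refl)
  countᵇ-≥2 (x ∷ xs) zero    (suc j) _ e e′ rewrite e = s≤s (countᵇ-≥1 xs j e′)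
  countᵇ-≥2 (x ∷ xs) (suc i) zero    _ e e′ rewrite e′ = s≤s (countᵇ-≥1 xs i e)
  countᵇ-≥2 (x ∷ xs) (suc i) (suc j) i≢j e e′ with P x
  ... | true  = ℕP.m≤n⇒m≤1+n (countᵇ-≥2 xs i j (i≢j ∘ cong suc) e e′)
  ... | false = countᵇ-≥2 xs i j (i≢j ∘ cong suc) e e′

  countᵇ-sum : ∀ {n} (xs : Vec A n) → countᵇ P xs ≡ sum (λ i → if P (lookup xs i) then 1 else 0)
  countᵇ-sum [] = refl
  countᵇ-sum (x ∷ xs) with P x
  ... | true  = cong suc (countᵇ-sum xs)
  ... | false = countᵇ-sum xs

  countᵇ-permute : ∀ {n} (xs : Vec A n) (σ : Permutation′ n)
                 → countᵇ P (tabulate (lookup xs ∘ (σ ⟨$⟩ʳ_))) ≡ countᵇ P xs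
  countᵇ-permute {n} xs σ = begin
    countᵇ P (tabulate (lookup xs ∘ (σ ⟨$⟩ʳ_)))
      ≡⟨ countᵇ-sum (tabulate (lookup xs ∘ (σ ⟨$⟩ʳ_))) ⟩
    sum {n} (λ i → if P (lookup (tabulate (lookup xs ∘ (σ ⟨$⟩ʳ_))) i) then 1 else 0)
      ≡⟨ sum-cong-≗ (λ i → cong (λ x → if P x then 1 else 0) (VecP.lookup∘tabulate (lookup xs ∘ (σ ⟨$⟩ʳ_)) i)) ⟩
    sum {n} (λ i → if P (lookup xs (σ ⟨$⟩ʳ i)) then 1 else 0)
      ≡⟨ sum-permute (λ i → if P (lookup xs i) then 1 else 0) σ ⟨
    sum (λ i → if P (lookup xs i) then 1 else 0)
      ≡⟨ countᵇ-sum xs ⟨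
    countᵇ P xs ∎
    where open ≡-Reasoning

countᵇ-cong : ∀ {A B : Set} (P : A → Bool) (Q : B → Bool) {n} (xs : Vec A n) (ys : Vec B n)
            → (∀ i → P (lookup xs i) ≡ Q (lookup ys i)) → countᵇ P xs ≡ countᵇ Q ys
countᵇ-cong P Q [] [] h = refl
countᵇ-cong P Q (x ∷ xs) (y ∷ ys) h with P x | Q y | h zero
... | true  | true  | _ = cong suc (countᵇ-cong P Q xs ys (h ∘ suc))
... | false | false | _ = countᵇ-cong P Q xs ys (h ∘ suc)

T-foldr-∧⇒All : ∀ {A : Set} (g : A → Bool) (xs : List A)
      → T (List.foldr (λ x r → g x ∧ r) true xs) → All (T ∘ g) xs
T-foldr-∧⇒All g [] _ = []
T-foldr-∧⇒All g (x ∷ xs) t = let gx , rest = Equivalence.to T-∧ t in gx ∷ T-foldr-∧⇒All g xs rest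

All⇒T-foldr-∧ : ∀ {A : Set} (g : A → Bool) {xs : List A}
      → All (T ∘ g) xs → T (List.foldr (λ x r → g x ∧ r) true xs)
All⇒T-foldr-∧ g [] = _
All⇒T-foldr-∧ g (gx ∷ rest) = Equivalence.from T-∧ (gx , All⇒T-foldr-∧ g rest)

-- Walks towards the root

module _ {n : ℕ} (p : Parents n) where

  walk : ℕ → Maybe (Fin n) → Maybe (Fin n)
  walk k = iter k (step p)

  walk-+ : ∀ a b x → walk (a + b) x ≡ walk b (walk a x)
  walk-+ zero    b x = refl
  walk-+ (suc a) b x = walk-+ a b (step p x)

  walk-nothing : ∀ k → walk k nothing ≡ nothing
  walk-nothing zero    = refl
  walk-nothing (suc k) = walk-nothing k

  walk-mono : ∀ {k k′} x → k ≤ k′ → walk k x ≡ nothing → walk k′ x ≡ nothing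
  walk-mono {k} {k′} x k≤k′ e = begin
    walk k′ x                 ≡⟨ cong (λ m → walk m x) (ℕP.m+[n∸m]≡n k≤k′) ⟨
    walk (k + (k′ ∸ k)) x     ≡⟨ walk-+ k (k′ ∸ k) x ⟩
    walk (k′ ∸ k) (walk k x)  ≡⟨ cong (walk (k′ ∸ k)) e ⟩
    walk (k′ ∸ k) nothing     ≡⟨ walk-nothing (k′ ∸ k) ⟩
    nothing                   ∎
    where open ≡-Reasoning

  walk-shortcut : ∀ {a b k} x → b ≤ k → walk a x ≡ walk b x → walk (a + (k ∸ b)) x ≡ walk k x
  walk-shortcut {a} {b} {k} x b≤k e = begin
    walk (a + (k ∸ b)) x      ≡⟨ walk-+ a (k ∸ b) x ⟩
    walk (k ∸ b) (walk a x)   ≡⟨ cong (walk (k ∸ b)) e ⟩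
    walk (k ∸ b) (walk b x)   ≡⟨ walk-+ b (k ∸ b) x ⟨
    walk (b + (k ∸ b)) x      ≡⟨ cong (λ m → walk m x) (ℕP.m+[n∸m]≡n b≤k) ⟩
    walk k x                  ∎
    where open ≡-Reasoning

  -- A walk of length k > n visits n + 1 vertices twice (pigeonhole), so it can be shortened.
  walk-within : ∀ j k → walk k (just j) ≡ nothing → walk n (just j) ≡ nothing
  walk-within j = ℕInd.<-rec _ go
    where
    vertexAt : Fin (suc n) → Fin n
    vertexAt i = Maybe.fromMaybe j (walk (toℕ i) (just j))

    go : ∀ k → (∀ {k′} → k′ < k → walk k′ (just j) ≡ nothing → walk n (just j) ≡ nothing)
       → walk k (just j) ≡ nothing → walk n (just j) ≡ nothing
    go k rec e with k ℕP.≤? n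
    ... | yes k≤n = walk-mono (just j) k≤n e
    ... | no k≰n
      with a , b , a<b , same ← FinP.pigeonhole (ℕP.n<1+n n) vertexAt
      with walk (toℕ a) (just j) in ea | walk (toℕ b) (just j) in eb
    ... | nothing | _ = walk-mono (just j) (ℕP.≤-pred (FinP.toℕ<n a)) ea
    ... | just _ | nothing = walk-mono (just j) (ℕP.≤-pred (FinP.toℕ<n b)) eb
    ... | just u | just v = rec shorter (trans (walk-shortcut {toℕ a} (just j) b≤k (trans ea (trans (cong just same) (sym eb)))) e)
      where
      b≤k : toℕ b ≤ k
      b≤k = ℕP.≤-trans (ℕP.≤-pred (FinP.toℕ<n b)) (ℕP.<⇒≤ (ℕP.≰⇒> k≰n))
      shorter : toℕ a + (k ∸ toℕ b) < k
      shorter = subst (toℕ a + (k ∸ toℕ b) <_) (ℕP.m+[n∸m]≡n b≤k) (ℕP.+-monoˡ-< (k ∸ toℕ b) {toℕ a} {toℕ b} a<b)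

Acyclic : ∀ {n} → Parents n → Set
Acyclic {n} p = ∀ j → walk p n (just j) ≡ nothing

is-nothing⇒≡nothing : ∀ {A : Set} {x : Maybe A} → T (is-nothing x) → x ≡ nothing
is-nothing⇒≡nothing {x = nothing} _ = refl

≡nothing⇒is-nothing : ∀ {A : Set} {x : Maybe A} → x ≡ nothing → T (is-nothing x)
≡nothing⇒is-nothing refl = _

true≢false : true ≢ false
true≢false ()

just≢nothing : ∀ {A : Set} {x : A} → just x ≢ nothing
just≢nothing ()

is-just≡false : ∀ {A : Set} {x : Maybe A} → Maybe.is-just x ≡ false → x ≡ nothing
is-just≡false {x = nothing} _ = refl

is-nothing-map : ∀ {A B : Set} (g : A → B) (x : Maybe A) → is-nothing (Maybe.map g x) ≡ is-nothing x
is-nothing-map g nothing  = refl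
is-nothing-map g (just _) = refl

module _ {n : ℕ} {p : Parents n} where

  isTree⇒oneRoot : T (isTree p) → countᵇ is-nothing p ≡ 1
  isTree⇒oneRoot t = ℕP.≡ᵇ⇒≡ _ 1 (proj₁ (Equivalence.to T-∧ t))

  isTree⇒acyclic : T (isTree p) → Acyclic p
  isTree⇒acyclic t = is-nothing⇒≡nothing ∘ AllP.tabulate⁻ (T-foldr-∧⇒All _ _ (proj₂ (Equivalence.to T-∧ t)))

  isTree-intro : countᵇ is-nothing p ≡ 1 → Acyclic p → T (isTree p)
  isTree-intro oneRoot acyclic =
    Equivalence.from T-∧ (ℕP.≡⇒≡ᵇ _ 1 oneRoot , All⇒T-foldr-∧ _ (AllP.tabulate⁺ (≡nothing⇒is-nothing ∘ acyclic)))

  parent≢self : Acyclic p → ∀ j → lookup p j ≢ just j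
  parent≢self acyclic j e = just≢nothing (trans (sym (stays n)) (acyclic j))
    where
    stays : ∀ k → walk p k (just j) ≡ just j
    stays zero    = refl
    stays (suc k) = trans (cong (walk p k) e) (stays k)

Tree-≡ : ∀ {n} {T₁ T₂ : Tree n} → proj₁ T₁ ≡ proj₁ T₂ → T₁ ≡ T₂
Tree-≡ {T₁ = p , t} refl = cong (p ,_) (T-irrelevant t _)

module _ {n : ℕ} (u : Fin n) where

  isChildOf-self : isChildOf u (just u) ≡ true
  isChildOf-self with u FinP.≟ u
  ... | yes _   = refl
  ... | no u≢u = ⊥-elim (u≢u refl)

  isChildOf⇒parent : ∀ y → isChildOf u y ≡ true → y ≡ just u
  isChildOf⇒parent (just q) e with q FinP.≟ u
  ... | yes q≡u = cong just q≡u

isChildOf-map-injective : ∀ {N M} (g : Fin N → Fin M) → (∀ {a b} → g a ≡ g b → a ≡ b)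
                        → ∀ u y → isChildOf (g u) (Maybe.map g y) ≡ isChildOf u y
isChildOf-map-injective g g-inj u nothing = refl
isChildOf-map-injective g g-inj u (just q) with q FinP.≟ u | g q FinP.≟ g u
... | yes _   | yes _   = refl
... | no _    | no _    = refl
... | yes q≡u | no ne   = ⊥-elim (ne (cong g q≡u))
... | no ne   | yes e   = ⊥-elim (ne (g-inj e))

isChildOf-≢just : ∀ {N} (u : Fin N) y → y ≢ just u → isChildOf u y ≡ false
isChildOf-≢just u y y≢u with isChildOf u y in e
... | true  = ⊥-elim (y≢u (isChildOf⇒parent u y e))
... | false = refl

-- Relabelling vertices

module _ {n : ℕ} (σ : Permutation′ n) where

  lookup-actTree : (p : Parents n) (j : Fin n) → lookup (actTree p σ) j ≡ Maybe.map (σ ⟨$⟩ˡ_) (lookup p (σ ⟨$⟩ʳ j))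
  lookup-actTree p j = VecP.lookup∘tabulate _ j

  walk-actTree : (p : Parents n) → ∀ k x → walk (actTree p σ) k (Maybe.map (σ ⟨$⟩ˡ_) x) ≡ Maybe.map (σ ⟨$⟩ˡ_) (walk p k x)
  walk-actTree p zero    x        = refl
  walk-actTree p (suc k) nothing  = walk-actTree p k nothing
  walk-actTree p (suc k) (just u) = begin
    walk (actTree p σ) k (lookup (actTree p σ) (σ ⟨$⟩ˡ u))
      ≡⟨ cong (walk (actTree p σ) k) (lookup-actTree p (σ ⟨$⟩ˡ u)) ⟩
    walk (actTree p σ) k (Maybe.map (σ ⟨$⟩ˡ_) (lookup p (σ ⟨$⟩ʳ (σ ⟨$⟩ˡ u))))
      ≡⟨ cong (λ v → walk (actTree p σ) k (Maybe.map (σ ⟨$⟩ˡ_) (lookup p v))) (inverseʳ σ) ⟩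
    walk (actTree p σ) k (Maybe.map (σ ⟨$⟩ˡ_) (lookup p u))
      ≡⟨ walk-actTree p k (lookup p u) ⟩
    Maybe.map (σ ⟨$⟩ˡ_) (walk p k (lookup p u)) ∎
    where open ≡-Reasoning

  actTree-acyclic : (p : Parents n) → Acyclic p → Acyclic (actTree p σ)
  actTree-acyclic p acyclic j = begin
    walk (actTree p σ) n (just j)                         ≡⟨ cong (walk (actTree p σ) n ∘ just) (inverseˡ σ) ⟨
    walk (actTree p σ) n (just (σ ⟨$⟩ˡ (σ ⟨$⟩ʳ j)))      ≡⟨ walk-actTree p n (just (σ ⟨$⟩ʳ j)) ⟩
    Maybe.map (σ ⟨$⟩ˡ_) (walk p n (just (σ ⟨$⟩ʳ j)))     ≡⟨ cong (Maybe.map (σ ⟨$⟩ˡ_)) (acyclic (σ ⟨$⟩ʳ j)) ⟩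
    nothing                                               ∎
    where open ≡-Reasoning

  countᵇ-actTree : (P : Maybe (Fin n) → Bool) (Q : Maybe (Fin n) → Bool)
                 → (∀ y → P (Maybe.map (σ ⟨$⟩ˡ_) y) ≡ Q y)
                 → (p : Parents n) → countᵇ P (actTree p σ) ≡ countᵇ Q p
  countᵇ-actTree P Q P∘map≡Q p =
    trans (countᵇ-cong P Q (actTree p σ) (tabulate (lookup p ∘ (σ ⟨$⟩ʳ_)))
            (λ i → trans (cong P (lookup-actTree p i))
                   (trans (P∘map≡Q _) (cong Q (sym (VecP.lookup∘tabulate _ i))))))
          (countᵇ-permute Q p σ)

  actTree-isTree : (p : Parents n) → T (isTree p) → T (isTree (actTree p σ))
  actTree-isTree p t = isTree-intro
    (trans (countᵇ-actTree is-nothing is-nothing (is-nothing-map _) p) (isTree⇒oneRoot {p = p} t))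
    (actTree-acyclic p (isTree⇒acyclic {p = p} t))

  isChildOf-map : (j : Fin n) (y : Maybe (Fin n)) → isChildOf j (Maybe.map (σ ⟨$⟩ˡ_) y) ≡ isChildOf (σ ⟨$⟩ʳ j) y
  isChildOf-map j y = trans (cong (λ i → isChildOf i (Maybe.map (σ ⟨$⟩ˡ_) y)) (sym (inverseˡ σ)))
                            (isChildOf-map-injective (σ ⟨$⟩ˡ_) ⟨$⟩ˡ-injective (σ ⟨$⟩ʳ j) y)
    where
    ⟨$⟩ˡ-injective : ∀ {a b} → σ ⟨$⟩ˡ a ≡ σ ⟨$⟩ˡ b → a ≡ b
    ⟨$⟩ˡ-injective e = trans (sym (inverseʳ σ)) (trans (cong (σ ⟨$⟩ʳ_) e) (inverseʳ σ))

  children-actTree : (p : Parents n) (j : Fin n)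
                   → countᵇ (isChildOf j) (actTree p σ) ≡ countᵇ (isChildOf (σ ⟨$⟩ʳ j)) p
  children-actTree p j = countᵇ-actTree (isChildOf j) (isChildOf (σ ⟨$⟩ʳ j)) (isChildOf-map j) p

  actTree-flip : (p : Parents n) → actTree (actTree p σ) (flip σ) ≡ p
  actTree-flip p = vec-ext λ j → begin
    lookup (actTree (actTree p σ) (flip σ)) j
      ≡⟨ VecP.lookup∘tabulate _ j ⟩
    Maybe.map (σ ⟨$⟩ʳ_) (lookup (actTree p σ) (σ ⟨$⟩ˡ j))
      ≡⟨ cong (Maybe.map (σ ⟨$⟩ʳ_)) (lookup-actTree p (σ ⟨$⟩ˡ j)) ⟩
    Maybe.map (σ ⟨$⟩ʳ_) (Maybe.map (σ ⟨$⟩ˡ_) (lookup p (σ ⟨$⟩ʳ (σ ⟨$⟩ˡ j))))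
      ≡⟨ cong (λ y → Maybe.map (σ ⟨$⟩ʳ_) (Maybe.map (σ ⟨$⟩ˡ_) (lookup p y))) (inverseʳ σ) ⟩
    Maybe.map (σ ⟨$⟩ʳ_) (Maybe.map (σ ⟨$⟩ˡ_) (lookup p j))
      ≡⟨ map-inverse (lookup p j) ⟩
    lookup p j ∎
    where
    open ≡-Reasoning
    map-inverse : ∀ y → Maybe.map (σ ⟨$⟩ʳ_) (Maybe.map (σ ⟨$⟩ˡ_) y) ≡ y
    map-inverse nothing  = refl
    map-inverse (just q) = cong just (inverseʳ σ)

actT : ∀ {n} → Tree n → Permutation′ n → Tree n
actT (p , t) σ = actTree p σ , actTree-isTree σ p t

fword-actT : ∀ {n} (Y : Tree n) (σ : Permutation′ n) → fword (actT Y σ) ≡ actWord (fword Y) σ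
fword-actT (p , t) σ = VecP.tabulate-cong λ j →
  trans (children-actTree σ p j) (sym (VecP.lookup∘tabulate (f (p , t)) (σ ⟨$⟩ʳ j)))

actT-flip : ∀ {n} (Y : Tree n) (σ : Permutation′ n) → actT (actT Y σ) (flip σ) ≡ Y
actT-flip (p , t) σ = Tree-≡ (actTree-flip σ p)

isLeaf : ℕ → Bool
isLeaf zero    = true
isLeaf (suc _) = false

leaves : ∀ {n} → Tree n → ℕ
leaves Y = countᵇ isLeaf (fword Y)

leaves-actT : ∀ {n} (Y : Tree n) (σ : Permutation′ n) → leaves (actT Y σ) ≡ leaves Y
leaves-actT Y σ = trans (cong (countᵇ isLeaf) (fword-actT Y σ)) (countᵇ-permute isLeaf (fword Y) σ)

leafCount-< : ∀ {x y s t} → 1 ≤ s → t ≡ 0 → countᵇ isLeaf (suc x ∷ s ∷ []) < countᵇ isLeaf (suc y ∷ t ∷ [])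
leafCount-< {s = suc s} _ refl = s≤s z≤n

embed : ∀ {n} → Fin (suc n) → Fin (n + 2)
embed {zero}  zero    = zero
embed {suc n} zero    = zero
embed {suc n} (suc v) = suc (embed v)

lastVertex : ∀ {n} → Fin (n + 2)
lastVertex {zero}  = suc zero
lastVertex {suc n} = suc (lastVertex {n})

penultimate : ∀ {n} → Fin (n + 2)
penultimate {n} = embed (fromℕ n)

unembed : ∀ {n} → Fin (n + 2) → Fin (suc n)
unembed {zero}  _       = zero
unembed {suc n} zero    = zero
unembed {suc n} (suc i) = suc (unembed i)

unembed-embed : ∀ {n} (v : Fin (suc n)) → unembed (embed v) ≡ v
unembed-embed {zero}  zero    = refl
unembed-embed {suc n} zero    = refl
unembed-embed {suc n} (suc v) = cong suc (unembed-embed v)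

embed-unembed : ∀ {n} (i : Fin (n + 2)) → i ≢ lastVertex → embed (unembed i) ≡ i
embed-unembed {zero}  zero       _  = refl
embed-unembed {zero}  (suc zero) ne = ⊥-elim (ne refl)
embed-unembed {suc n} zero       _  = refl
embed-unembed {suc n} (suc i)    ne = cong suc (embed-unembed i (ne ∘ cong suc))

embed≢lastVertex : ∀ {n} (v : Fin (suc n)) → embed v ≢ lastVertex
embed≢lastVertex {zero}  zero ()
embed≢lastVertex {suc n} zero ()
embed≢lastVertex {suc n} (suc v) e = embed≢lastVertex v (FinP.suc-injective e)

embed-injective : ∀ {n} {u v : Fin (suc n)} → embed u ≡ embed v → u ≡ v
embed-injective {u = u} {v} e = trans (sym (unembed-embed u)) (trans (cong unembed e) (unembed-embed v))

penultimate≢lastVertex : ∀ {n} → penultimate {n} ≢ lastVertex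
penultimate≢lastVertex {n} = embed≢lastVertex (fromℕ n)

vertex-cases : ∀ {n} (i : Fin (n + 2)) → (∃ λ v → i ≡ embed v) ⊎ i ≡ lastVertex
vertex-cases i with i FinP.≟ lastVertex
... | yes e  = inj₂ e
... | no ne = inj₁ (unembed i , sym (embed-unembed i ne))

-- Moving a leaf to the last position

IsLeafWithParent : ∀ {n} → Parents n → Fin n → Fin n → Set
IsLeafWithParent p ℓ b = lookup p ℓ ≡ just b × countᵇ (isChildOf ℓ) p ≡ 0

module _ {n : ℕ} {p : Parents n} (t : T (isTree p)) where

  -- Descend from a non-root vertex through children; acyclicity bounds the descent by n steps.
  ∃-leaf : ∀ {x₀ b₀} → lookup p x₀ ≡ just b₀ → ∃₂ λ ℓ b → IsLeafWithParent p ℓ b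
  ∃-leaf {x₀} {b₀} x₀↦b₀ = descend n 0 x₀ x₀↦b₀ refl (ℕP.+-identityʳ n)
    where
    descend : ∀ fuel m x {b} → lookup p x ≡ just b → walk p m (just x) ≡ just x₀ → fuel + m ≡ n
            → ∃₂ λ ℓ b → IsLeafWithParent p ℓ b
    descend zero m x _ reaches refl = ⊥-elim (just≢nothing (trans (sym reaches) (isTree⇒acyclic t x)))
    descend (suc fuel) m x x↦b reaches fuel+m≡n with countᵇ (isChildOf x) p ℕP.≟ 0
    ... | yes leaf = x , _ , x↦b , leaf
    ... | no  ¬leaf =
      let c , c-child = countᵇ≢0⇒∃ (isChildOf x) p ¬leaf
          c↦x = isChildOf⇒parent x (lookup p c) c-child
      in descend fuel (suc m) c c↦x (trans (cong (walk p m) c↦x) reaches) (trans (ℕP.+-suc fuel m) fuel+m≡n)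

  relabel-leaf : ∀ (σ : Permutation′ n) {ℓ b} → IsLeafWithParent p ℓ b
               → IsLeafWithParent (actTree p σ) (σ ⟨$⟩ˡ ℓ) (σ ⟨$⟩ˡ b)
  relabel-leaf σ {ℓ} (ℓ↦b , leaf) =
      trans (lookup-actTree σ p (σ ⟨$⟩ˡ ℓ)) (cong (Maybe.map (σ ⟨$⟩ˡ_)) (trans (cong (lookup p) (inverseʳ σ)) ℓ↦b))
    , trans (children-actTree σ p (σ ⟨$⟩ˡ ℓ)) (trans (cong (λ v → countᵇ (isChildOf v) p) (inverseʳ σ)) leaf)

module _ {n : ℕ} where

  transpose-swaps : (i j : Fin n) → transpose i j ⟨$⟩ˡ j ≡ i
  transpose-swaps i j with j FinP.≟ j
  ... | yes _   = refl
  ... | no j≢j = ⊥-elim (j≢j refl)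

  transpose-fixes : (i j k : Fin n) → k ≢ i → k ≢ j → transpose i j ⟨$⟩ˡ k ≡ k
  transpose-fixes i j k k≢i k≢j with k FinP.≟ j
  ... | yes k≡j = ⊥-elim (k≢j k≡j)
  ... | no _ with k FinP.≟ i
  ...   | yes k≡i = ⊥-elim (k≢i k≡i)
  ...   | no _    = refl

normalise : ∀ {n} {p : Parents (n + 2)} → T (isTree p)
        → ∃₂ λ σ τ → IsLeafWithParent (actTree (actTree p σ) τ) lastVertex penultimate
normalise {p = p} t = σ , τ , leaf₂
  where
  nonRoot : ∃₂ λ x b → lookup p x ≡ just b
  nonRoot with lookup p penultimate in e₀ | lookup p lastVertex in e₁
  ... | just b  | _       = penultimate , b , e₀
  ... | nothing | just b  = lastVertex , b , e₁
  ... | nothing | nothing = ⊥-elim (ℕP.<-irrefl refl (subst (2 ≤_) (isTree⇒oneRoot {p = p} t)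
          (countᵇ-≥2 is-nothing p penultimate lastVertex penultimate≢lastVertex (cong is-nothing e₀) (cong is-nothing e₁))))
  leaf₀ = ∃-leaf t (proj₂ (proj₂ nonRoot))
  ℓ = proj₁ leaf₀
  b = proj₁ (proj₂ leaf₀)
  σ = transpose penultimate b
  ℓ₁ = σ ⟨$⟩ˡ ℓ
  leaf₁ : IsLeafWithParent (actTree p σ) ℓ₁ penultimate
  leaf₁ = subst (IsLeafWithParent (actTree p σ) ℓ₁) (transpose-swaps penultimate b)
                (relabel-leaf t σ (proj₂ (proj₂ leaf₀)))
  τ = transpose lastVertex ℓ₁
  penultimate≢ℓ₁ : penultimate ≢ ℓ₁
  penultimate≢ℓ₁ e = parent≢self (isTree⇒acyclic (actTree-isTree σ p t)) ℓ₁ (trans (proj₁ leaf₁) (cong just e))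
  leaf₂ : IsLeafWithParent (actTree (actTree p σ) τ) lastVertex penultimate
  leaf₂ = subst₂ (IsLeafWithParent (actTree (actTree p σ) τ))
                 (transpose-swaps lastVertex ℓ₁)
                 (transpose-fixes lastVertex ℓ₁ penultimate penultimate≢lastVertex penultimate≢ℓ₁)
                 (relabel-leaf (actTree-isTree σ p t) τ leaf₁)

module _ {A : Set} where

  lookup-graftLast-embed : ∀ {n} (u : Vec A (suc n)) (w : Vec A 2) {v} → v ≢ fromℕ n
                         → lookup (graft (fromℕ n) u w) (embed v) ≡ lookup u v
  lookup-graftLast-embed {zero}  (x ∷ []) w {zero}  v≢k = ⊥-elim (v≢k refl)
  lookup-graftLast-embed {suc n} (x ∷ u)  w {zero}  v≢k = refl
  lookup-graftLast-embed {suc n} (x ∷ u)  w {suc v} v≢k = lookup-graftLast-embed u w (v≢k ∘ cong suc)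

  lookup-graftLast-penultimate : ∀ {n} (u : Vec A (suc n)) (w : Vec A 2)
                               → lookup (graft (fromℕ n) u w) penultimate ≡ lookup w zero
  lookup-graftLast-penultimate {zero}  (x ∷ []) (a ∷ b ∷ []) = refl
  lookup-graftLast-penultimate {suc n} (x ∷ u)  w            = lookup-graftLast-penultimate u w

  lookup-graftLast-last : ∀ {n} (u : Vec A (suc n)) (w : Vec A 2)
                        → lookup (graft (fromℕ n) u w) lastVertex ≡ lookup w (suc zero)
  lookup-graftLast-last {zero}  (x ∷ []) (a ∷ b ∷ []) = refl
  lookup-graftLast-last {suc n} (x ∷ u)  w            = lookup-graftLast-last u w

  countᵇ-graftLast-< : ∀ (P : A → Bool) {n} (u : Vec A (suc n)) {w w′ : Vec A 2}
                     → countᵇ P w < countᵇ P w′ → countᵇ P (graft (fromℕ n) u w) < countᵇ P (graft (fromℕ n) u w′)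
  countᵇ-graftLast-< P {zero}  (x ∷ []) {a ∷ b ∷ []} {a′ ∷ b′ ∷ []} lt = lt
  countᵇ-graftLast-< P {suc n} (x ∷ u) lt with P x
  ... | true  = s≤s (countᵇ-graftLast-< P u lt)
  ... | false = countᵇ-graftLast-< P u lt

graftedVertex : ∀ {n} → Fin 2 → Fin (n + 2)
graftedVertex zero       = penultimate
graftedVertex (suc zero) = lastVertex

embS-fromℕ : ∀ n (b : Fin 2) → embS {n} (fromℕ n) b ≡ graftedVertex b
embS-fromℕ zero    zero       = refl
embS-fromℕ zero    (suc zero) = refl
embS-fromℕ (suc n) zero       = cong suc (embS-fromℕ n zero)
embS-fromℕ (suc n) (suc zero) = cong suc (embS-fromℕ n (suc zero))

embT-fromℕ : ∀ n (v : Fin (suc n)) (ne : fromℕ n ≢ v) → embT {n} {2} (fromℕ n) (punchOut ne) ≡ embed v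
embT-fromℕ zero    zero    ne = ⊥-elim (ne refl)
embT-fromℕ (suc n) zero    ne = refl
embT-fromℕ (suc n) (suc v) ne = cong suc (embT-fromℕ n v (ne ∘ cong suc))

countᵇ-split-last : ∀ {A : Set} (P : A → Bool) {n} (xs : Vec A (n + 2))
                  → countᵇ P xs ≡ countᵇ P (tabulate (lookup xs ∘ embed)) + countᵇ P (lookup xs lastVertex ∷ [])
countᵇ-split-last P {zero} (x ∷ y ∷ []) with P x | P y
... | true  | true  = refl
... | true  | false = refl
... | false | true  = refl
... | false | false = refl
countᵇ-split-last P {suc n} (x ∷ xs) with P x
... | true  = cong suc (countᵇ-split-last P xs)
... | false = countᵇ-split-last P xs

Rehung : ∀ {N} → Fin N → Fin N → Maybe (Fin N) → Maybe (Fin N) → Set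
Rehung ℓ b y y₀ = y ≡ y₀ ⊎ (y ≡ just ℓ × y₀ ≡ just b)

-- Re-hanging some children of b under a child ℓ of b keeps a tree a tree.
module _ {N : ℕ} {p q : Parents N} {ℓ b : Fin N} (ℓ↦b : lookup q ℓ ≡ just b)
         (rehung : ∀ j → Rehung ℓ b (lookup q j) (lookup p j)) where

  rehang-reaches : ∀ m x → walk p m x ≡ nothing → ∃ λ m′ → walk q m′ x ≡ nothing
  rehang-reaches m       nothing  _ = 0 , refl
  rehang-reaches zero    (just j) ()
  rehang-reaches (suc m) (just j) e with rehung j
  ... | inj₁ q≡p =
    let m′ , e′ = rehang-reaches m (lookup p j) e
    in suc m′ , trans (cong (walk q m′) q≡p) e′
  ... | inj₂ (j↦ℓ , j↦b) =
    let m′ , e′ = rehang-reaches m (just b) (trans (cong (walk p m) (sym j↦b)) e)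
    in suc (suc m′) , trans (cong (walk q (suc m′)) j↦ℓ) (trans (cong (walk q m′) ℓ↦b) e′)

  rehang-isTree : T (isTree p) → T (isTree q)
  rehang-isTree t = isTree-intro
    (trans (countᵇ-cong is-nothing is-nothing q p sameRoots) (isTree⇒oneRoot {p = p} t))
    (λ j → let m′ , e = rehang-reaches N (just j) (isTree⇒acyclic {p = p} t j) in walk-within q j m′ e)
    where
    sameRoots : ∀ j → is-nothing (lookup q j) ≡ is-nothing (lookup p j)
    sameRoots j with rehung j
    ... | inj₁ q≡p = cong is-nothing q≡p
    ... | inj₂ (j↦ℓ , j↦b) rewrite j↦ℓ | j↦b = refl

Compatible : ∀ {N m L} → Fin N → Vec (Maybe (Fin N)) L → Vec (Maybe (Fin m)) L → Set
Compatible k v a = ∀ i → Maybe.is-just (lookup a i) ≡ isChildOf k (lookup v i)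

compatible-∷ : ∀ {N m L} {k : Fin N} {x v} {y : Maybe (Fin m)} {a : Vec _ L}
             → Maybe.is-just y ≡ isChildOf k x → Compatible k v a → Compatible k (x ∷ v) (y ∷ a)
compatible-∷ e c zero    = e
compatible-∷ e c (suc i) = c i

assignments-compatible : ∀ {N} m (k : Fin N) {L} (v : Vec (Maybe (Fin N)) L) → All (Compatible k v) (assignments m k v)
assignments-compatible m k [] = (λ ()) ∷ []
assignments-compatible m k (x ∷ v) with isChildOf k x in x-child
... | true  = AllP.concat⁺ (AllP.map⁺ {f = λ b → List.map (just b ∷_) (assignments m k v)} (AllP.tabulate⁺ {f = id} λ _ →
                AllP.gmap⁺ (compatible-∷ (sym x-child)) (assignments-compatible m k v)))
... | false = AllP.gmap⁺ (compatible-∷ (sym x-child)) (assignments-compatible m k v)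

-- an assignment records just b at each child it sends to b
sentTo : ∀ {m L} → Fin m → Vec (Maybe (Fin m)) L → ℕ
sentTo b = countᵇ (isChildOf b)

-- the exponents of the term X_{1 + #a⁻¹(0)} X_{#a⁻¹(1)} of D^c (X₁ X₀) indexed by an assignment a
generatorLetters : ∀ {L} → Vec (Maybe (Fin 2)) L → Vec ℕ 2
generatorLetters a = suc (sentTo zero a) ∷ sentTo (suc zero) a ∷ []

record HeadSplit {L} (as : List (Vec (Maybe (Fin 2)) L)) : Set where
  constructor split
  field
    a₀              : Vec (Maybe (Fin 2)) L
    rest            : List (Vec (Maybe (Fin 2)) L)
    as≡             : as ≡ a₀ ∷ rest
    a₀-keepsLeaf    : ∀ i → isChildOf (suc zero) (lookup a₀ i) ≡ false
    rest-movesChild : All (λ a → 1 ≤ sentTo (suc zero) a) rest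

assignments-split : ∀ {N L} (k : Fin N) (v : Vec (Maybe (Fin N)) L) → HeadSplit (assignments 2 k v)
assignments-split k [] = split [] [] refl (λ ()) []
assignments-split k (x ∷ v) with isChildOf k x | assignments-split k v
... | true  | split a₀ rest eq a₀-ok rest-ok rewrite eq =
  split (just zero ∷ a₀) _ refl (λ { zero → refl ; (suc i) → a₀-ok i })
        (AllP.++⁺ (AllP.gmap⁺ id rest-ok) (AllP.++⁺ (AllP.map⁺ (All.universal (λ _ → s≤s z≤n) (a₀ ∷ rest))) []))
... | false | split a₀ rest eq a₀-ok rest-ok rewrite eq =
  split (nothing ∷ a₀) _ refl (λ { zero → refl ; (suc i) → a₀-ok i }) (AllP.gmap⁺ id rest-ok)

-- Pruning the last leaf, and grafting it back in all possible ways

graftedVertex-injective : ∀ {n} {b b′ : Fin 2} → graftedVertex {n} b ≡ graftedVertex b′ → b ≡ b′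
graftedVertex-injective {b = zero}     {zero}     _ = refl
graftedVertex-injective {b = zero}     {suc zero} e = ⊥-elim (penultimate≢lastVertex e)
graftedVertex-injective {b = suc zero} {zero}     e = ⊥-elim (penultimate≢lastVertex (sym e))
graftedVertex-injective {b = suc zero} {suc zero} _ = refl

graftedVertex≢embed : ∀ {n} (b : Fin 2) {v : Fin (suc n)} → v ≢ fromℕ n → graftedVertex b ≢ embed v
graftedVertex≢embed zero       v≢k e = v≢k (sym (embed-injective e))
graftedVertex≢embed (suc zero) v≢k e = embed≢lastVertex _ (sym e)

GraftView : ∀ {n} → Fin (n + 2) → Set
GraftView {n} i = (∃ λ v → v ≢ fromℕ n × i ≡ embed v) ⊎ (∃ λ b → i ≡ graftedVertex b)

graftView : ∀ {n} (i : Fin (n + 2)) → GraftView i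
graftView {n} i with vertex-cases i
... | inj₂ i≡last = inj₂ (suc zero , i≡last)
... | inj₁ (v , i≡v) with v FinP.≟ fromℕ n
...   | yes refl = inj₂ (zero , i≡v)
...   | no v≢k   = inj₁ (v , v≢k , i≡v)

module Pruning {n : ℕ} {pY : Parents (n + 2)} (tY : T (isTree pY))
               (lastLeaf : IsLeafWithParent pY lastVertex penultimate) where

  k : Fin (suc n)
  k = fromℕ n

  last↦penultimate : lookup pY lastVertex ≡ just penultimate
  last↦penultimate = proj₁ lastLeaf

  ≢↦last : ∀ i → lookup pY i ≢ just lastVertex
  ≢↦last i i↦last = true≢false (begin
    true                       ≡⟨ isChildOf-self last ⟨
    isChildOf last (just last) ≡⟨ cong (isChildOf last) i↦last ⟨
    isChildOf last (lookup pY i) ≡⟨ countᵇ≡0⇒all-false (isChildOf last) pY (proj₂ lastLeaf) i ⟩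
    false                      ∎)
    where
    open ≡-Reasoning
    last = lastVertex {n}

  pruned : Parents (suc n)
  pruned = tabulate (Maybe.map unembed ∘ lookup pY ∘ embed)

  embed-pruned : ∀ v → Maybe.map embed (lookup pruned v) ≡ lookup pY (embed v)
  embed-pruned v rewrite VecP.lookup∘tabulate (Maybe.map unembed ∘ lookup pY ∘ embed) v
    with lookup pY (embed v) in e
  ... | nothing = refl
  ... | just q  = cong just (embed-unembed q λ q≡last → ≢↦last (embed v) (trans e (cong just q≡last)))

  isChildOf-pruned : ∀ u v → isChildOf u (lookup pruned v) ≡ isChildOf (embed u) (lookup pY (embed v))
  isChildOf-pruned u v = trans (sym (isChildOf-map-injective embed embed-injective u (lookup pruned v)))
                               (cong (isChildOf (embed u)) (embed-pruned v))

  walk-pruned : ∀ m x → Maybe.map embed (walk pruned m x) ≡ walk pY m (Maybe.map embed x)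
  walk-pruned zero    x        = refl
  walk-pruned (suc m) nothing  = trans (cong (Maybe.map embed) (walk-nothing pruned m)) (sym (walk-nothing pY m))
  walk-pruned (suc m) (just v) = trans (walk-pruned m (lookup pruned v)) (cong (walk pY m) (embed-pruned v))

  pruned-isTree : T (isTree pruned)
  pruned-isTree = isTree-intro oneRoot acyclic
    where
    oneRoot : countᵇ is-nothing pruned ≡ 1
    oneRoot = begin
      countᵇ is-nothing pruned
        ≡⟨ countᵇ-cong is-nothing is-nothing pruned (tabulate (lookup pY ∘ embed)) (λ v →
             trans (sym (is-nothing-map embed (lookup pruned v)))
                   (trans (cong is-nothing (embed-pruned v))
                          (cong is-nothing (sym (VecP.lookup∘tabulate (lookup pY ∘ embed) v))))) ⟩
      countᵇ is-nothing (tabulate (lookup pY ∘ embed))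
        ≡⟨ ℕP.+-identityʳ _ ⟨
      countᵇ is-nothing (tabulate (lookup pY ∘ embed)) + countᵇ is-nothing (just (penultimate {n}) ∷ [])
        ≡⟨ cong (λ y → countᵇ is-nothing (tabulate (lookup pY ∘ embed)) + countᵇ is-nothing (y ∷ [])) last↦penultimate ⟨
      countᵇ is-nothing (tabulate (lookup pY ∘ embed)) + countᵇ is-nothing (lookup pY lastVertex ∷ [])
        ≡⟨ countᵇ-split-last is-nothing pY ⟨
      countᵇ is-nothing pY
        ≡⟨ isTree⇒oneRoot {p = pY} tY ⟩
      1 ∎
      where open ≡-Reasoning
    acyclic : Acyclic pruned
    acyclic v = walk-within pruned v (n + 2)
      (unmap (walk pruned (n + 2) (just v)) (trans (walk-pruned (n + 2) (just v)) (isTree⇒acyclic {p = pY} tY (embed v))))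
      where
      unmap : ∀ x → Maybe.map embed x ≡ nothing → x ≡ nothing
      unmap nothing _ = refl

  T′ : Tree (suc n)
  T′ = pruned , pruned-isTree

  grafted : Vec (Maybe (Fin 2)) (suc n) → Parents (n + 2)
  grafted = graftTree k pruned (proj₁ genTree)

  reattach : Maybe (Fin 2) → Maybe (Fin (n + 2)) → Maybe (Fin (n + 2))
  reattach a y = Maybe.maybe (just ∘ graftedVertex) y a

  mapT-unembed : ∀ q → q ≢ lastVertex → q ≢ penultimate → mapT k (unembed q) ≡ just q
  mapT-unembed q q≢last q≢pen with k FinP.≟ unembed q
  ... | yes k≡q = ⊥-elim (q≢pen (trans (sym (embed-unembed q q≢last)) (cong embed (sym k≡q))))
  ... | no k≢q  = cong just (trans (embT-fromℕ n (unembed q) k≢q) (embed-unembed q q≢last))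

  pruned-bind : ∀ v → lookup pY (embed v) ≢ just penultimate → (lookup pruned v >>= mapT k) ≡ lookup pY (embed v)
  pruned-bind v v↦̸pen rewrite VecP.lookup∘tabulate (Maybe.map unembed ∘ lookup pY ∘ embed) v
    with lookup pY (embed v) in e
  ... | nothing = refl
  ... | just q  = mapT-unembed q (λ q≡last → ≢↦last (embed v) (trans e (cong just q≡last)))
                                 (v↦̸pen ∘ cong just)

  lookup-grafted-last : ∀ a → lookup (grafted a) lastVertex ≡ just penultimate
  lookup-grafted-last a = trans (lookup-graftLast-last {n = n} _ _) (cong just (embS-fromℕ n zero))

  module _ {a : Vec (Maybe (Fin 2)) (suc n)} (compatible : Compatible k pruned a) where

    assigned-child : ∀ v {b} → lookup a v ≡ just b → lookup pY (embed v) ≡ just penultimate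
    assigned-child v {b} e = isChildOf⇒parent penultimate (lookup pY (embed v))
      (trans (sym (isChildOf-pruned k v)) (trans (sym (compatible v)) (cong Maybe.is-just e)))

    unassigned-non-child : ∀ v → lookup a v ≡ nothing → isChildOf penultimate (lookup pY (embed v)) ≡ false
    unassigned-non-child v e = trans (sym (isChildOf-pruned k v)) (trans (sym (compatible v)) (cong Maybe.is-just e))

    lookup-grafted-embed : ∀ v → lookup (grafted a) (embed v) ≡ reattach (lookup a v) (lookup pY (embed v))
    lookup-grafted-embed v with v FinP.≟ k
    ... | yes refl = begin
      lookup (grafted a) penultimate    ≡⟨ lookup-graftLast-penultimate {n = n} _ _ ⟩
      (lookup pruned k >>= mapT k)      ≡⟨ pruned-bind k (parent≢self (isTree⇒acyclic {p = pY} tY) penultimate) ⟩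
      lookup pY penultimate             ≡⟨ cong (λ x → reattach x (lookup pY penultimate)) k-unassigned ⟨
      reattach (lookup a k) (lookup pY penultimate) ∎
      where
      open ≡-Reasoning
      k-unassigned : lookup a k ≡ nothing
      k-unassigned = is-just≡false (trans (compatible k) (trans (isChildOf-pruned k k)
                       (isChildOf-≢just penultimate _ (parent≢self (isTree⇒acyclic {p = pY} tY) penultimate))))
    ... | no v≢k = trans (lookup-graftLast-embed _ _ v≢k)
                         (trans (VecP.lookup-zipWith _ v pruned a) (reattach-lookup (lookup a v) refl))
      where
      reattach-lookup : ∀ x → lookup a v ≡ x
        → Maybe.maybe (just ∘ embS k) (lookup pruned v >>= mapT k) x ≡ reattach x (lookup pY (embed v))
      reattach-lookup (just b) _ = cong just (embS-fromℕ n b)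
      reattach-lookup nothing  e = pruned-bind v λ v↦pen →
        true≢false (trans (sym (isChildOf-self (penultimate {n})))
                   (trans (cong (isChildOf penultimate) (sym v↦pen)) (unassigned-non-child v e)))

    grafted-isTree : T (isTree (grafted a))
    grafted-isTree = rehang-isTree (lookup-grafted-last a) rehung tY
      where
      rehung : ∀ j → Rehung lastVertex penultimate (lookup (grafted a) j) (lookup pY j)
      rehung j with vertex-cases j
      ... | inj₂ refl = inj₁ (trans (lookup-grafted-last a) (sym last↦penultimate))
      ... | inj₁ (v , refl) rewrite lookup-grafted-embed v = cases (lookup a v) refl
        where
        cases : ∀ x → lookup a v ≡ x → Rehung lastVertex penultimate (reattach x (lookup pY (embed v))) (lookup pY (embed v))
        cases nothing           _ = inj₁ refl
        cases (just zero)       e = inj₁ (sym (assigned-child v e))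
        cases (just (suc zero)) e = inj₂ (refl , assigned-child v e)

    grafted-unchanged : (∀ v → isChildOf (suc zero) (lookup a v) ≡ false) → grafted a ≡ pY
    grafted-unchanged noneToLeaf = vec-ext λ j → unchanged j (vertex-cases j)
      where
      keeps : ∀ v x → lookup a v ≡ x → reattach x (lookup pY (embed v)) ≡ lookup pY (embed v)
      keeps v nothing           _ = refl
      keeps v (just zero)       e = sym (assigned-child v e)
      keeps v (just (suc zero)) e = ⊥-elim (true≢false (trans (cong (isChildOf (suc zero)) (sym e)) (noneToLeaf v)))
      unchanged : ∀ j → (∃ λ v → j ≡ embed v) ⊎ j ≡ lastVertex → lookup (grafted a) j ≡ lookup pY j
      unchanged _ (inj₂ refl)       = trans (lookup-grafted-last a) (sym last↦penultimate)
      unchanged _ (inj₁ (v , refl)) = trans (lookup-grafted-embed v) (keeps v (lookup a v) refl)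

    reattached : Vec (Maybe (Fin (n + 2))) (suc n)
    reattached = tabulate λ v → reattach (lookup a v) (lookup pY (embed v))

    lookup-reattached : ∀ v → lookup reattached v ≡ reattach (lookup a v) (lookup pY (embed v))
    lookup-reattached = VecP.lookup∘tabulate (λ v → reattach (lookup a v) (lookup pY (embed v)))

    children-grafted : ∀ i → countᵇ (isChildOf i) (grafted a)
                           ≡ countᵇ (isChildOf i) reattached + countᵇ (isChildOf i) (just penultimate ∷ [])
    children-grafted i = trans (countᵇ-split-last (isChildOf i) (grafted a))
      (cong₂ _+_ (cong (countᵇ (isChildOf i)) (VecP.tabulate-cong lookup-grafted-embed))
                 (cong (λ y → countᵇ (isChildOf i) (y ∷ [])) (lookup-grafted-last a)))

    children-graftedVertex : ∀ b → countᵇ (isChildOf (graftedVertex b)) reattached ≡ sentTo b a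
    children-graftedVertex b = countᵇ-cong (isChildOf (graftedVertex b)) (isChildOf b) reattached a λ v →
      trans (cong (isChildOf (graftedVertex b)) (lookup-reattached v)) (pointwise v (lookup a v) refl)
      where
      pointwise : ∀ v x → lookup a v ≡ x → isChildOf (graftedVertex b) (reattach x (lookup pY (embed v))) ≡ isChildOf b x
      pointwise v (just b′) _ = isChildOf-map-injective graftedVertex graftedVertex-injective b (just b′)
      pointwise v nothing e = unassigned-non-child′ b
        where
        unassigned-non-child′ : ∀ b → isChildOf (graftedVertex b) (lookup pY (embed v)) ≡ false
        unassigned-non-child′ zero       = unassigned-non-child v e
        unassigned-non-child′ (suc zero) = isChildOf-≢just lastVertex _ (≢↦last (embed v))

    children-embed : ∀ v → v ≢ k → countᵇ (isChildOf (embed v)) reattached ≡ countᵇ (isChildOf v) pruned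
    children-embed v v≢k = countᵇ-cong (isChildOf (embed v)) (isChildOf v) reattached pruned λ w →
      trans (cong (isChildOf (embed v)) (lookup-reattached w))
            (trans (pointwise w (lookup a w) refl) (sym (isChildOf-pruned v w)))
      where
      pointwise : ∀ w x → lookup a w ≡ x
                → isChildOf (embed v) (reattach x (lookup pY (embed w))) ≡ isChildOf (embed v) (lookup pY (embed w))
      pointwise w nothing  _ = refl
      pointwise w (just b) e rewrite assigned-child w e =
        trans (isChildOf-≢just (embed v) _ (graftedVertex≢embed b v≢k ∘ just-injective))
              (sym (isChildOf-≢just (embed v) _ (graftedVertex≢embed zero v≢k ∘ just-injective)))

    fword-grafted : fword (grafted a , grafted-isTree) ≡ graft k (fword T′) (generatorLetters a)
    fword-grafted = vec-ext λ i → trans (VecP.lookup∘tabulate (f (grafted a , grafted-isTree)) i)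
                                        (trans (children-grafted i) (letter i (graftView i)))
      where
      w = generatorLetters a
      open ≡-Reasoning
      letter : ∀ i → GraftView i
             → countᵇ (isChildOf i) reattached + countᵇ (isChildOf i) (just penultimate ∷ []) ≡ lookup (graft k (fword T′) w) i
      letter _ (inj₁ (v , v≢k , refl))
        rewrite isChildOf-≢just (embed v) (just penultimate) (graftedVertex≢embed zero v≢k ∘ just-injective) = begin
        countᵇ (isChildOf (embed v)) reattached + 0   ≡⟨ ℕP.+-identityʳ _ ⟩
        countᵇ (isChildOf (embed v)) reattached       ≡⟨ children-embed v v≢k ⟩
        f T′ v                                        ≡⟨ VecP.lookup∘tabulate (f T′) v ⟨
        lookup (fword T′) v                           ≡⟨ lookup-graftLast-embed (fword T′) w v≢k ⟨
        lookup (graft k (fword T′) w) (embed v)       ∎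
      letter _ (inj₂ (zero , refl)) rewrite isChildOf-self (penultimate {n}) = begin
        countᵇ (isChildOf penultimate) reattached + 1 ≡⟨ ℕP.+-comm _ 1 ⟩
        suc (countᵇ (isChildOf penultimate) reattached) ≡⟨ cong suc (children-graftedVertex zero) ⟩
        suc (sentTo zero a)                           ≡⟨ lookup-graftLast-penultimate (fword T′) w ⟨
        lookup (graft k (fword T′) w) penultimate     ∎
      letter _ (inj₂ (suc zero , refl))
        rewrite isChildOf-≢just (lastVertex {n}) (just penultimate) (penultimate≢lastVertex ∘ just-injective) = begin
        countᵇ (isChildOf lastVertex) reattached + 0  ≡⟨ ℕP.+-identityʳ _ ⟩
        countᵇ (isChildOf lastVertex) reattached      ≡⟨ children-graftedVertex (suc zero) ⟩
        sentTo (suc zero) a                           ≡⟨ lookup-graftLast-last (fword T′) w ⟨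
        lookup (graft k (fword T′) w) lastVertex      ∎

  module _ {a₀ : Vec (Maybe (Fin 2)) (suc n)} (compatible₀ : Compatible k pruned a₀)
           (keepsLeaf : ∀ v → isChildOf (suc zero) (lookup a₀ v) ≡ false) where

    fword-unchanged : fword (pY , tY) ≡ graft k (fword T′) (generatorLetters a₀)
    fword-unchanged = trans (cong fword (Tree-≡ {T₁ = pY , tY} {T₂ = grafted a₀ , grafted-isTree compatible₀}
                                                (sym (grafted-unchanged compatible₀ keepsLeaf))))
                            (fword-grafted compatible₀)

    grafted-fewerLeaves : ∀ {a} (compatible : Compatible k pruned a) → 1 ≤ sentTo (suc zero) a
                        → leaves (grafted a , grafted-isTree compatible) < leaves (pY , tY)
    grafted-fewerLeaves {a} compatible toLeaf =
      subst₂ (λ u u′ → countᵇ isLeaf u < countᵇ isLeaf u′) (sym (fword-grafted compatible)) (sym fword-unchanged)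
        (countᵇ-graftLast-< isLeaf (fword T′) {generatorLetters a} {generatorLetters a₀}
          (leafCount-< {x = sentTo zero a} {y = sentTo zero a₀} toLeaf
            (all-false⇒countᵇ≡0 (isChildOf (suc zero)) a₀ keepsLeaf)))

-- Coefficients in NMI

module Linear {c ℓ : Level} (K : CommutativeRing c ℓ) where

  open CommutativeRing K
    renaming (_+_ to _+K_; _*_ to _*K_; refl to ≈-refl; sym to ≈-sym; trans to ≈-trans; zero to *-zero)
  open Lin K
  open import Algebra.Properties.Group +-group using (∙-cancelʳ)

  _≟w_ : ∀ {n} (u w : Vec ℕ n) → _
  _≟w_ = VecP.≡-dec ℕP._≟_

  sumOver : ∀ {A : Set} → List A → (A → Carrier) → Carrier
  sumOver xs g = List.foldr (λ x r → g x +K r) 0# xs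

  linearExtension : ∀ {n} → (Vec ℕ n → Carrier) → NMI n → Carrier
  linearExtension g = List.foldr (λ cw r → proj₁ cw *K g (proj₂ cw) +K r) 0#

  sumOver-map : ∀ {A B : Set} (f : A → B) (xs : List A) (g : B → Carrier)
              → sumOver (List.map f xs) g ≡ sumOver xs (g ∘ f)
  sumOver-map f []       g = refl
  sumOver-map f (x ∷ xs) g = cong (g (f x) +K_) (sumOver-map f xs g)

  sumOver-congAll : ∀ {A : Set} {xs : List A} {g h : A → Carrier} → All (λ x → g x ≈ h x) xs → sumOver xs g ≈ sumOver xs h
  sumOver-congAll []       = ≈-refl
  sumOver-congAll (e ∷ es) = +-cong e (sumOver-congAll es)

  coeff-++ : ∀ {n} (P Q : NMI n) w → coeff (P List.++ Q) w ≈ coeff P w +K coeff Q w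
  coeff-++ []            Q w = ≈-sym (+-identityˡ _)
  coeff-++ ((d , u) ∷ P) Q w with u ≟w w
  ... | yes _ = ≈-trans (+-congˡ (coeff-++ P Q w)) (≈-sym (+-assoc _ _ _))
  ... | no _  = coeff-++ P Q w

  coeff-concatMap : ∀ {A : Set} {n} (F : A → NMI n) (xs : List A) w
                  → coeff (concatMap F xs) w ≈ sumOver xs (λ x → coeff (F x) w)
  coeff-concatMap F []       w = ≈-refl
  coeff-concatMap F (x ∷ xs) w = ≈-trans (coeff-++ (F x) (concatMap F xs) w) (+-congˡ (coeff-concatMap F xs w))

  coeff-scale : ∀ {n} (s : Carrier) (P : NMI n) w → coeff (List.map (λ ew → s *K proj₁ ew , proj₂ ew) P) w ≈ s *K coeff P w
  coeff-scale s []            w = ≈-sym (zeroʳ s)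
  coeff-scale s ((e , u) ∷ P) w with u ≟w w
  ... | yes _ = ≈-trans (+-congˡ (coeff-scale s P w)) (≈-sym (distribˡ s e _))
  ... | no _  = coeff-scale s P w

  coeff-units : ∀ {A : Set} {n} (word : A → Vec ℕ n) (xs : List A) w
              → coeff (List.map (λ x → 1# , word x) xs) w ≈ sumOver xs (λ x → coeff (monomial (word x)) w)
  coeff-units word []       w = ≈-refl
  coeff-units word (x ∷ xs) w with word x ≟w w
  ... | yes _ = +-cong (≈-sym (+-identityʳ 1#)) (coeff-units word xs w)
  ... | no _  = ≈-trans (coeff-units word xs w) (≈-sym (+-identityˡ _))

  linearExtension-monomial : ∀ {n} (g : Vec ℕ n → Carrier) u → linearExtension g (monomial u) ≈ g u
  linearExtension-monomial g u = ≈-trans (+-identityʳ _) (*-identityˡ _)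

  without : ∀ {n} → Vec ℕ n → NMI n → NMI n
  without x []            = []
  without x ((d , u) ∷ P) = if does (u ≟w x) then without x P else (d , u) ∷ without x P

  length-without : ∀ {n} (x : Vec ℕ n) P → length (without x P) ≤ length P
  length-without x []            = z≤n
  length-without x ((d , u) ∷ P) with u ≟w x
  ... | yes _ = ℕP.m≤n⇒m≤1+n (length-without x P)
  ... | no _  = s≤s (length-without x P)

  linearExtension-without : ∀ {n} (g : Vec ℕ n → Carrier) x P
                          → linearExtension g P ≈ coeff P x *K g x +K linearExtension g (without x P)
  linearExtension-without g x [] = ≈-sym (≈-trans (+-congʳ (zeroˡ _)) (+-identityˡ _))
  linearExtension-without g x ((d , u) ∷ P) with u ≟w x
  ... | yes refl = begin
    d *K g u +K linearExtension g P                                     ≈⟨ +-congˡ (linearExtension-without g u P) ⟩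
    d *K g u +K (coeff P u *K g u +K linearExtension g (without u P))   ≈⟨ +-assoc _ _ _ ⟨
    (d *K g u +K coeff P u *K g u) +K linearExtension g (without u P)   ≈⟨ +-congʳ (distribʳ (g u) d _) ⟨
    (d +K coeff P u) *K g u +K linearExtension g (without u P)          ∎
    where open ≈-Reasoning setoid
  ... | no _ = ≈-trans (+-congˡ (linearExtension-without g x P)) (x+[y+z]≈y+[x+z] _ _ _)
    where
    open ≈-Reasoning setoid
    x+[y+z]≈y+[x+z] : ∀ a b c′ → a +K (b +K c′) ≈ b +K (a +K c′)
    x+[y+z]≈y+[x+z] a b c′ = begin
      a +K (b +K c′)   ≈⟨ +-assoc a b c′ ⟨
      (a +K b) +K c′   ≈⟨ +-congʳ (+-comm a b) ⟩
      (b +K a) +K c′   ≈⟨ +-assoc b a c′ ⟩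
      b +K (a +K c′)   ∎

  coeff-without-same : ∀ {n} x (P : NMI n) → coeff (without x P) x ≈ 0#
  coeff-without-same x []            = ≈-refl
  coeff-without-same x ((d , u) ∷ P) with u ≟w x
  ... | yes _ = coeff-without-same x P
  ... | no u≢x with u ≟w x
  ...   | yes u≡x = ⊥-elim (u≢x u≡x)
  ...   | no _    = coeff-without-same x P

  coeff-without-other : ∀ {n} x (P : NMI n) w → w ≢ x → coeff (without x P) w ≈ coeff P w
  coeff-without-other x [] w w≢x = ≈-refl
  coeff-without-other x ((d , u) ∷ P) w w≢x with u ≟w x
  ... | yes refl with u ≟w w
  ...   | yes u≡w = ⊥-elim (w≢x (sym u≡w))
  ...   | no _    = coeff-without-other x P w w≢x
  coeff-without-other x ((d , u) ∷ P) w w≢x | no _ with u ≟w w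
  ...   | yes _ = +-congˡ (coeff-without-other x P w w≢x)
  ...   | no _  = coeff-without-other x P w w≢x

  without-cong : ∀ {n} x {P Q : NMI n} → P ≈N Q → without x P ≈N without x Q
  without-cong x {P} {Q} P≈Q w with w ≟w x
  ... | yes refl = ≈-trans (coeff-without-same w P) (≈-sym (coeff-without-same w Q))
  ... | no w≢x   = ≈-trans (coeff-without-other x P w w≢x) (≈-trans (P≈Q w) (≈-sym (coeff-without-other x Q w w≢x)))

  length-without-head : ∀ {n} d (x : Vec ℕ n) P → length (without x ((d , x) ∷ P)) ≤ length P
  length-without-head d x P with x ≟w x
  ... | yes _  = length-without x P
  ... | no x≢x = ⊥-elim (x≢x refl)

  -- Remove the terms in one word on both sides, by induction on the total length.
  linearExtension-cong : ∀ {n} (g : Vec ℕ n → Carrier) {P Q : NMI n} → P ≈N Q → linearExtension g P ≈ linearExtension g Q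
  linearExtension-cong g {P} {Q} = bounded (length P + length Q) {P} {Q} ℕP.≤-refl
    where
    open ≈-Reasoning setoid
    bounded : ∀ N {P Q} → length P + length Q ≤ N → P ≈N Q → linearExtension g P ≈ linearExtension g Q
    removing : ∀ N x {P Q} → length (without x P) + length (without x Q) ≤ N → P ≈N Q
             → linearExtension g P ≈ linearExtension g Q

    bounded N       {[]}          {[]}          _          _   = ≈-refl
    bounded (suc N) {(d , x) ∷ P} {Q}           (s≤s size) P≈Q =
      removing N x {(d , x) ∷ P} {Q} (ℕP.≤-trans (ℕP.+-mono-≤ (length-without-head d x P) (length-without x Q)) size) P≈Q
    bounded (suc N) {[]}          {(d , x) ∷ Q} (s≤s size) P≈Q =
      removing N x {[]} {(d , x) ∷ Q} (ℕP.≤-trans (length-without-head d x Q) size) P≈Q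

    removing N x {P} {Q} size P≈Q = begin
      linearExtension g P                                 ≈⟨ linearExtension-without g x P ⟩
      coeff P x *K g x +K linearExtension g (without x P)
        ≈⟨ +-cong (*-congʳ (P≈Q x)) (bounded N {without x P} {without x Q} size (without-cong x {P} {Q} P≈Q)) ⟩
      coeff Q x *K g x +K linearExtension g (without x Q) ≈⟨ linearExtension-without g x Q ⟨
      linearExtension g Q                                 ∎

  coeff-compNMI : ∀ {n′ m} (k : Fin (suc n′)) (P : NMI (suc n′)) (Q : NMI m) w
                → coeff (compNMI k P Q) w ≈ linearExtension (λ u → linearExtension (λ v → coeff (compWord k u v) w) Q) P
  coeff-compNMI k []            Q w = ≈-refl
  coeff-compNMI k ((d , u) ∷ P) Q w =
    ≈-trans (coeff-++ (terms Q) (compNMI k P Q) w) (+-cong (coeff-terms Q) (coeff-compNMI k P Q w))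
    where
    open ≈-Reasoning setoid
    terms : NMI _ → NMI _
    terms = concatMap (λ dv → List.map (λ ew → (d *K proj₁ dv) *K proj₁ ew , proj₂ ew) (compWord k u (proj₂ dv)))
    coeff-terms : ∀ Q′ → coeff (terms Q′) w ≈ d *K linearExtension (λ v → coeff (compWord k u v) w) Q′
    coeff-terms [] = ≈-sym (zeroʳ d)
    coeff-terms ((e , v) ∷ Q′) = begin
      coeff (terms ((e , v) ∷ Q′)) w
        ≈⟨ coeff-++ (List.map (λ ew → (d *K e) *K proj₁ ew , proj₂ ew) (compWord k u v)) (terms Q′) w ⟩
      coeff (List.map (λ ew → (d *K e) *K proj₁ ew , proj₂ ew) (compWord k u v)) w +K coeff (terms Q′) w
        ≈⟨ +-cong (coeff-scale (d *K e) (compWord k u v) w) (coeff-terms Q′) ⟩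
      (d *K e) *K coeff (compWord k u v) w +K d *K linearExtension (λ v → coeff (compWord k u v) w) Q′
        ≈⟨ +-congʳ (*-assoc d e _) ⟩
      d *K (e *K coeff (compWord k u v) w) +K d *K linearExtension (λ v → coeff (compWord k u v) w) Q′
        ≈⟨ distribˡ d _ _ ⟨
      d *K linearExtension (λ v → coeff (compWord k u v) w) ((e , v) ∷ Q′) ∎

  compNMI-monomials : ∀ {n′ m} (k : Fin (suc n′)) {P : NMI (suc n′)} {Q : NMI m} {u v}
                    → P ≈N monomial u → Q ≈N monomial v → compNMI k P Q ≈N compWord k u v
  compNMI-monomials k {P} {Q} {u} {v} P≈u Q≈v w = begin
    coeff (compNMI k P Q) w                    ≈⟨ coeff-compNMI k P Q w ⟩
    linearExtension (outer Q) P                ≈⟨ linearExtension-cong (outer Q) {P} {monomial u} P≈u ⟩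
    linearExtension (outer Q) (monomial u)     ≈⟨ linearExtension-monomial (outer Q) u ⟩
    linearExtension (inner u) Q                ≈⟨ linearExtension-cong (inner u) {Q} {monomial v} Q≈v ⟩
    linearExtension (inner u) (monomial v)     ≈⟨ linearExtension-monomial (inner u) v ⟩
    coeff (compWord k u v) w                   ∎
    where
    open ≈-Reasoning setoid
    inner : Vec ℕ _ → Vec ℕ _ → Carrier
    inner u′ v′ = coeff (compWord k u′ v′) w
    outer : NMI _ → Vec ℕ _ → Carrier
    outer Q′ u′ = linearExtension (inner u′) Q′

  iterD-++ : ∀ {n} c (P Q : NMI n) → iter c D (P List.++ Q) ≡ iter c D P List.++ iter c D Q
  iterD-++ zero    P Q = refl
  iterD-++ (suc c) P Q = trans (cong (iter c D) (ListP.concatMap-++ _ P Q)) (iterD-++ c (D P) (D Q))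

  iterD-[] : ∀ {n} c → iter c D ([] {A = Carrier × Vec ℕ n}) ≡ []
  iterD-[] zero    = refl
  iterD-[] (suc c) = iterD-[] c

  -- D^c (X_x X_y), expanded over the ways of distributing the c derivations among the two letters
  iterD-pair : ∀ {N L} (k : Fin N) (v : Vec (Maybe (Fin N)) L) x y
             → iter (countᵇ (isChildOf k) v) D (monomial (x ∷ y ∷ []))
             ≡ List.map (λ a → 1# , (x + sentTo zero a ∷ y + sentTo (suc zero) a ∷ [])) (assignments 2 k v)
  iterD-pair k [] x y =
    cong (λ z → (1# , z) ∷ []) (cong₂ (λ x′ y′ → x′ ∷ y′ ∷ []) (sym (ℕP.+-identityʳ x)) (sym (ℕP.+-identityʳ y)))
  iterD-pair k (z ∷ v) x y with isChildOf k z
  ... | false = trans (iterD-pair k v x y) (ListP.map-∘ (assignments 2 k v))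
  ... | true  = begin
    iter c′ D (monomial (suc x ∷ y ∷ []) List.++ monomial (x ∷ suc y ∷ []))
      ≡⟨ iterD-++ c′ (monomial (suc x ∷ y ∷ [])) (monomial (x ∷ suc y ∷ [])) ⟩
    iter c′ D (monomial (suc x ∷ y ∷ [])) List.++ iter c′ D (monomial (x ∷ suc y ∷ []))
      ≡⟨ cong₂ List._++_ (iterD-pair k v (suc x) y) (iterD-pair k v x (suc y)) ⟩
    List.map (W (suc x) y) A List.++ List.map (W x (suc y)) A
      ≡⟨ cong₂ List._++_
           (sendTo zero λ a → cong (λ x′ → 1# , (x′ ∷ y + sentTo (suc zero) a ∷ [])) (ℕP.+-suc x (sentTo zero a)))
           (sendTo (suc zero) λ a → cong (λ y′ → 1# , (x + sentTo zero a ∷ y′ ∷ [])) (ℕP.+-suc y (sentTo (suc zero) a))) ⟨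
    List.map (W x y) A₀ List.++ List.map (W x y) A₁
      ≡⟨ cong (List.map (W x y) A₀ List.++_) (ListP.++-identityʳ (List.map (W x y) A₁)) ⟨
    List.map (W x y) A₀ List.++ (List.map (W x y) A₁ List.++ [])
      ≡⟨ cong (List.map (W x y) A₀ List.++_) (ListP.map-++ (W x y) A₁ []) ⟨
    List.map (W x y) A₀ List.++ List.map (W x y) (A₁ List.++ [])
      ≡⟨ ListP.map-++ (W x y) A₀ _ ⟨
    List.map (W x y) (A₀ List.++ (A₁ List.++ [])) ∎
    where
    open ≡-Reasoning
    c′ = countᵇ (isChildOf k) v
    A = assignments 2 k v
    A₀ = List.map (just zero ∷_) A
    A₁ = List.map (just (suc zero) ∷_) A
    W : ∀ {L′} → ℕ → ℕ → Vec (Maybe (Fin 2)) L′ → Carrier × Vec ℕ 2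
    W x y a = 1# , (x + sentTo zero a ∷ y + sentTo (suc zero) a ∷ [])
    sendTo : ∀ b {x′ y′} → (∀ a → W x y (just b ∷ a) ≡ W x′ y′ a)
           → List.map (W x y) (List.map (just b ∷_) A) ≡ List.map (W x′ y′) A
    sendTo b e = trans (sym (ListP.map-∘ A)) (ListP.map-cong e A)

  compWord-generator : ∀ {n} (k : Fin (suc n)) (T : Tree (suc n))
                     → compWord k (fword T) (1 ∷ 0 ∷ [])
                     ≡ List.map (λ a → 1# , graft k (fword T) (generatorLetters a)) (assignments 2 k (proj₁ T))
  compWord-generator k T = begin
    List.map G (iter (lookup (fword T) k) D (monomial (1 ∷ 0 ∷ [])))
      ≡⟨ cong (λ c′ → List.map G (iter c′ D (monomial (1 ∷ 0 ∷ [])))) (VecP.lookup∘tabulate (f T) k) ⟩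
    List.map G (iter (countᵇ (isChildOf k) (proj₁ T)) D (monomial (1 ∷ 0 ∷ [])))
      ≡⟨ cong (List.map G) (iterD-pair k (proj₁ T) 1 0) ⟩
    List.map G (List.map (λ a → 1# , (1 + sentTo zero a ∷ 0 + sentTo (suc zero) a ∷ [])) (assignments 2 k (proj₁ T)))
      ≡⟨ ListP.map-∘ (assignments 2 k (proj₁ T)) ⟨
    List.map (λ a → 1# , graft k (fword T) (generatorLetters a)) (assignments 2 k (proj₁ T)) ∎
    where
    open ≡-Reasoning
    G : Carrier × Vec ℕ 2 → Carrier × Vec ℕ _
    G cv = proj₁ cv , graft k (fword T) (proj₂ cv)

  actWord-flip : ∀ {n} (u : Vec ℕ n) (σ : Permutation′ n) → actWord (actWord u σ) (flip σ) ≡ u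
  actWord-flip u σ = vec-ext λ j → trans (VecP.lookup∘tabulate _ j)
    (trans (VecP.lookup∘tabulate (lookup u ∘ (σ ⟨$⟩ʳ_)) (σ ⟨$⟩ˡ j)) (cong (lookup u) (inverseʳ σ)))

  does-actWord : ∀ {n} (σ : Permutation′ n) u w → does (actWord u σ ≟w w) ≡ does (u ≟w actWord w (flip σ))
  does-actWord σ u w =
    does-⇔ (mk⇔ (λ e → trans (sym (actWord-flip u σ)) (cong (λ z → actWord z (flip σ)) e))
                (λ e → trans (cong (λ z → actWord z σ) e) (actWord-flip w (flip σ))))
           (actWord u σ ≟w w) (u ≟w actWord w (flip σ))

  coeff-actNMI : ∀ {n} (σ : Permutation′ n) (P : NMI n) w → coeff (actNMI P σ) w ≡ coeff P (actWord w (flip σ))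
  coeff-actNMI σ []            w = refl
  coeff-actNMI σ ((d , u) ∷ P) w rewrite does-actWord σ u w | coeff-actNMI σ P w = refl

  module _ (θ : LinMaps) (isMorphism : IsOperadMorphism θ) (θ◁ : θ 2 genTree ≈N monomial (1 ∷ 0 ∷ [])) where
    open IsOperadMorphism isMorphism

    Holds : ∀ {N} → Tree N → Set ℓ
    Holds Y = θ _ Y ≈N monomial (fword Y)

    onParents-tree : ∀ {N} (Y : Tree N) → onParents θ (proj₁ Y) ≈N θ N Y
    onParents-tree (p , t) w with T? (isTree p)
    ... | yes t′ = reflexive (cong (λ t″ → coeff (θ _ (p , t″)) w) (T-irrelevant t′ t))
    ... | no ¬t  = ⊥-elim (¬t t)

    holds-actT : ∀ {N} (Y : Tree N) σ → Holds Y → Holds (actT Y σ)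
    holds-actT {N} Y σ holdsY w = begin
      coeff (θ N (actT Y σ)) w                         ≈⟨ onParents-tree (actT Y σ) w ⟨
      coeff (onParents θ (actTree (proj₁ Y) σ)) w      ≈⟨ equiv N Y σ w ⟩
      coeff (actNMI (θ N Y) σ) w                       ≡⟨ coeff-actNMI σ (θ N Y) w ⟩
      coeff (θ N Y) (actWord w (flip σ))               ≈⟨ holdsY (actWord w (flip σ)) ⟩
      coeff (monomial (fword Y)) (actWord w (flip σ))  ≡⟨ coeff-actNMI σ (monomial (fword Y)) w ⟨
      coeff (monomial (actWord (fword Y) σ)) w         ≡⟨ cong (λ u → coeff (monomial u) w) (fword-actT Y σ) ⟨
      coeff (monomial (fword (actT Y σ))) w            ∎
      where open ≈-Reasoning setoid

    holds-actT⁻ : ∀ {N} (Y : Tree N) σ → Holds (actT Y σ) → Holds Y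
    holds-actT⁻ Y σ holds = subst Holds (actT-flip Y σ) (holds-actT (actT Y σ) (flip σ) holds)

    -- θ (T ∘ₖ ◁), computed in PL and in NMI
    θ-∘-generator : ∀ {n} (k : Fin (suc n)) (T : Tree (suc n)) → Holds T → ∀ w
      → sumOver (assignments 2 k (proj₁ T)) (λ a → coeff (onParents θ (graftTree k (proj₁ T) (proj₁ genTree) a)) w)
      ≈ sumOver (assignments 2 k (proj₁ T)) (λ a → coeff (monomial (graft k (fword T) (generatorLetters a))) w)
    θ-∘-generator k T holdsT w = begin
      sumOver A (λ a → coeff (onParents θ (grafted a)) w)
        ≡⟨ sumOver-map grafted A (λ q → coeff (onParents θ q) w) ⟨
      sumOver (List.map grafted A) (λ q → coeff (onParents θ q) w)
        ≈⟨ coeff-concatMap (onParents θ) (List.map grafted A) w ⟨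
      coeff (onSum θ (compPL k (proj₁ T) (proj₁ genTree))) w
        ≈⟨ comp _ 2 k T genTree w ⟩
      coeff (compNMI k (θ _ T) (θ 2 genTree)) w
        ≈⟨ compNMI-monomials k {θ _ T} {θ 2 genTree} {fword T} {1 ∷ 0 ∷ []} holdsT θ◁ w ⟩
      coeff (compWord k (fword T) (1 ∷ 0 ∷ [])) w
        ≡⟨ cong (λ P → coeff P w) (compWord-generator k T) ⟩
      coeff (List.map (λ a → 1# , graft k (fword T) (generatorLetters a)) A) w
        ≈⟨ coeff-units (λ a → graft k (fword T) (generatorLetters a)) A w ⟩
      sumOver A (λ a → coeff (monomial (graft k (fword T) (generatorLetters a))) w) ∎
      where
      open ≈-Reasoning setoid
      A = assignments 2 k (proj₁ T)
      grafted = graftTree k (proj₁ T) (proj₁ genTree)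

    -- Y = T′ ∘ₖ ◁ minus the other trees of the composite, which have fewer leaves.
    holds-normal : ∀ {n} (Y : Tree (n + 2)) → IsLeafWithParent (proj₁ Y) lastVertex penultimate
                 → (∀ (T′ : Tree (suc n)) → Holds T′) → (∀ Z → leaves Z < leaves Y → Holds Z) → Holds Y
    holds-normal {n} Y@(pY , tY) lastLeaf holdsSmaller holdsFewerLeaves w =
      ∙-cancelʳ (sumOver rest wordCoeff) (coeff (θ _ Y) w) (coeff (monomial (fword Y)) w) (begin
        coeff (θ _ Y) w +K sumOver rest wordCoeff
          ≈⟨ +-cong (≈-trans (reflexive (cong (λ p → coeff (onParents θ p) w) a₀≡Y)) (onParents-tree Y w))
                    (sumOver-congAll (All.zipWith holds-rest (All.tail compatible , rest-movesChild))) ⟨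
        sumOver (a₀ ∷ rest) treeCoeff  ≡⟨ cong (λ as → sumOver as treeCoeff) as≡ ⟨
        sumOver A treeCoeff            ≈⟨ θ-∘-generator k T′ (holdsSmaller T′) w ⟩
        sumOver A wordCoeff            ≡⟨ cong (λ as → sumOver as wordCoeff) as≡ ⟩
        sumOver (a₀ ∷ rest) wordCoeff  ≡⟨ cong (λ u → coeff (monomial u) w +K sumOver rest wordCoeff)
                                                (fword-unchanged {a₀ = a₀} (All.head compatible) a₀-keepsLeaf) ⟨
        coeff (monomial (fword Y)) w +K sumOver rest wordCoeff ∎)
      where
      open ≈-Reasoning setoid
      open Pruning {pY = pY} tY lastLeaf
      A = assignments 2 k pruned
      open HeadSplit (assignments-split k pruned)
      compatible : All (Compatible k pruned) (a₀ ∷ rest)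
      compatible = subst (All (Compatible k pruned)) as≡ (assignments-compatible 2 k pruned)
      treeCoeff wordCoeff : Vec (Maybe (Fin 2)) (suc n) → Carrier
      treeCoeff a = coeff (onParents θ (grafted a)) w
      wordCoeff a = coeff (monomial (graft k (fword T′) (generatorLetters a))) w
      a₀≡Y : grafted a₀ ≡ pY
      a₀≡Y = grafted-unchanged (All.head compatible) a₀-keepsLeaf
      holds-rest : ∀ {a} → Compatible k pruned a × 1 ≤ sentTo (suc zero) a → treeCoeff a ≈ wordCoeff a
      holds-rest {a} (c , toLeaf) = ≈-trans (onParents-tree (grafted a , grafted-isTree c) w)
        (≈-trans (holdsFewerLeaves _ (grafted-fewerLeaves {a₀ = a₀} (All.head compatible) a₀-keepsLeaf c toLeaf) w)
                 (reflexive (cong (λ u → coeff (monomial u) w) (fword-grafted c))))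

    holds-by-leaves : ∀ n → (∀ (T′ : Tree (suc n)) → Holds T′) → ∀ (Y : Tree (n + 2)) → Holds Y
    holds-by-leaves n holdsSmaller Y = ℕInd.<-rec (λ m → ∀ Y → leaves Y ≡ m → Holds Y) inductionStep (leaves Y) Y refl
      where
      inductionStep : ∀ m → (∀ {m′} → m′ < m → ∀ Y → leaves Y ≡ m′ → Holds Y) → ∀ Y → leaves Y ≡ m → Holds Y
      inductionStep _ rec Y refl =
        holds-actT⁻ Y σ (holds-actT⁻ (actT Y σ) τ (holds-normal Z lastLeaf holdsSmaller λ Z′ fewer →
          rec (subst (leaves Z′ <_) (trans (leaves-actT (actT Y σ) τ) (leaves-actT Y σ)) fewer) Z′ refl))
        where
        normalForm = normalise (proj₂ Y)
        σ = proj₁ normalForm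
        τ = proj₁ (proj₂ normalForm)
        lastLeaf = proj₂ (proj₂ normalForm)
        Z = actT (actT Y σ) τ

    holds : ∀ N (Y : Tree N) → Holds Y
    holds zero          ([] , ())
    holds (suc zero)    ((nothing ∷ []) , _) = unit
    holds (suc zero)    ((just zero ∷ []) , ())
    holds (suc (suc n)) = subst (λ N → ∀ (Y : Tree N) → Holds Y) (ℕP.+-comm n 2) (holds-by-leaves n (holds (suc n)))

proposition2p17 : ∀ {c ℓ : Level} (K : CommutativeRing c ℓ) → Lin.IsFieldChar0 K
                  → (θ : Lin.LinMaps K) → Lin.IsOperadMorphism K θ
                  → Lin._≈N_ K (θ 2 genTree) (Lin.monomial K (1 ∷ 0 ∷ []))
                  → ∀ (n : ℕ) (T : Tree n) → Lin._≈N_ K (θ n T) (Lin.monomial K (fword T))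
proposition2p17 K _ θ isMorphism θ◁ = Linear.holds K θ isMorphism θ◁
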